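{- The constant domain principle $\forall x(A\vee B(x))\Rightarrow A\vee\forall x B(x)$ is derivable in QGPM (for all formulas $A$ and $B(x)$), but it is not derivable in QGP (i.e., there are formulas $A$, $B(x)$ for which the sequent $\forall x(A\vee B(x))\Rightarrow A\vee\forall x B(x)$ is not derivable in QGP).
   Context: Language: first-order, predicate symbols and constants, no function symbols; connectives $\top,\wedge,\vee,\rightarrow,\forall,\exists$; disjoint sets of free variables $a,b,\dots$ (only free) and bound variables $x,y,\dots$ (only bound); $A$ is a formula (so $x$ does not occur free in it). $\phi[u/x]$ is substitution; $\phi(a)$ is $\phi(x)$ with $a$ for $x$. QGPM: sequents $\Gamma\Rightarrow\Delta$ ($\Gamma,\Delta$ finite sets); axioms $\phi\Rightarrow\phi$, $\Rightarrow\top$; rules ($\wedge$L) $\Gamma,\phi,\psi\Rightarrow\Delta$ / $\Gamma,\phi\wedge\psi\Rightarrow\Delta$; ($\wedge$R) $\Gamma\Rightarrow\Delta,\phi$ and $\Gamma\Rightarrow\Delta,\psi$ / $\Gamma\Rightarrow\Delta,\phi\wedge\psi$; ($\vee$L) $\Gamma,\phi\Rightarrow\Delta$ and $\Gamma,\psi\Rightarrow\Delta$ / $\Gamma,\phi\vee\psi\Rightarrow\Delta$; ($\vee$R) $\Gamma\Rightarrow\Delta,\phi,\psi$ / $\Gamma\Rightarrow\Delta,\phi\vee\psi$; ($\rightarrow$L) $\Gamma,\psi\Rightarrow\Delta$ and $\Gamma\Rightarrow\Delta,\phi$ / $\Gamma,\phi\rightarrow\psi\Rightarrow\Delta$; ($\rightarrow$Rp)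 $\Gamma\Rightarrow\psi,\Delta$ / $\Gamma\Rightarrow\phi\rightarrow\psi,\Delta$; ($\forall$R) $\Gamma\Rightarrow\Delta,\phi(a)$ / $\Gamma\Rightarrow\Delta,\forall x\phi(x)$ with $a$ not occurring in the conclusion; ($\forall$L) $\Gamma,\phi[u/x]\Rightarrow\Delta$ / $\Gamma,\forall x\phi(x)\Rightarrow\Delta$, $u$ a constant or free variable; ($\exists$R) $\Gamma\Rightarrow\Delta,\phi[u/x]$ / $\Gamma\Rightarrow\Delta,\exists x\phi(x)$; ($\exists$L) $\Gamma,\phi(a)\Rightarrow\Delta$ / $\Gamma,\exists x\phi(x)\Rightarrow\Delta$ with $a$ not in the conclusion; (Weakening) $\Gamma\Rightarrow\Delta$ / $\Gamma,\Gamma_1\Rightarrow\Delta,\Delta_1$; (Cut) $\Gamma\Rightarrow\Delta,\phi$ and $\phi,\Gamma_1\Rightarrow\Delta_1$ / $\Gamma,\Gamma_1\Rightarrow\Delta,\Delta_1$. QGP: single-conclusion version with sequents $\Gamma\Rightarrow\theta$ (exactly one formula on the right); axioms $\phi\Rightarrow\phi$, $\Rightarrow\top$; rules ($\wedge$L) $\Gamma,\phi,\psi\Rightarrow\theta$ / $\Gamma,\phi\wedge\psi\Rightarrow\theta$; ($\wedge$R) $\Gamma\Rightarrow\phi$, $\Gamma\Rightarrow\psi$ / $\Gamma\Rightarrow\phi\wedge\psi$; ($\vee$L) $\Gamma,\phi\Rightarrow\theta$ and $\Gamma,\psi\Rightarrow\theta$ / $\Gamma,\phi\vee\psi\Rightarrow\theta$;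 ($\vee$R) $\Gamma\Rightarrow\phi_i$ / $\Gamma\Rightarrow\phi_1\vee\phi_2$; ($\rightarrow$L) $\Gamma,\psi\Rightarrow\theta$ and $\Gamma\Rightarrow\phi$ / $\Gamma,\phi\rightarrow\psi\Rightarrow\theta$; ($\rightarrow$Rp) $\Gamma\Rightarrow\psi$ / $\Gamma\Rightarrow\phi\rightarrow\psi$; ($\forall$R) $\Gamma\Rightarrow\phi(a)$ / $\Gamma\Rightarrow\forall x\phi(x)$ ($a$ not in conclusion); ($\forall$L) $\Gamma,\phi[u/x]\Rightarrow\theta$ / $\Gamma,\forall x\phi(x)\Rightarrow\theta$; ($\exists$R) $\Gamma\Rightarrow\phi[u/x]$ / $\Gamma\Rightarrow\exists x\phi(x)$; ($\exists$L) $\Gamma,\phi(a)\Rightarrow\theta$ / $\Gamma,\exists x\phi(x)\Rightarrow\theta$ ($a$ not in conclusion); (Weakening) $\Gamma\Rightarrow\theta$ / $\Gamma,\Gamma_1\Rightarrow\theta$; (Cut) $\Gamma\Rightarrow\phi$ and $\phi,\Gamma_1\Rightarrow\theta$ / $\Gamma,\Gamma_1\Rightarrow\theta$. -}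

module Defs where

open import Data.Nat using (ℕ; suc)
open import Data.Fin using (Fin; zero; suc)
open import Data.Vec using (Vec; map)
open import Data.Vec.Relation.Unary.Any as VAny using ()
open import Data.List using (List; []; _∷_; _++_)
open import Data.List.Relation.Unary.Any as LAny using ()
open import Data.List.Membership.Propositional using (_∈_)
open import Data.Product using (_×_)
open import Data.Empty using (⊥)
open import Data.Sum using (_⊎_)
open import Relation.Nullary using (¬_)
open import Relation.Binary.PropositionalEquality using (_≡_)

-- Locally nameless: free variables a,b,... are  fv a  (a : ℕ),
-- constants are  cn c,  bound variables are de Bruijn indices  bv i
-- with i : Fin n, n = number of enclosing binders.

data Tm (n : ℕ) : Set where
  fv : ℕ → Tm n
  cn : ℕ → Tm n
  bv : Fin n → Tm n

-- A predicate symbol is identified by a name p and its arity k.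
data Fm (n : ℕ) : Set where
  pr   : (p k : ℕ) → Vec (Tm n) k → Fm n
  ⊤'   : Fm n
  _∧'_ : Fm n → Fm n → Fm n
  _∨'_ : Fm n → Fm n → Fm n
  _⇒'_ : Fm n → Fm n → Fm n
  ∀'   : Fm (suc n) → Fm n
  ∃'   : Fm (suc n) → Fm n

infixr 6 _∧'_
infixr 5 _∨'_
infixr 4 _⇒'_

-- Formulas (closed w.r.t. bound variables) and closed terms
-- (= constants and free variables).
Formula : Set
Formula = Fm 0

Term : Set
Term = Tm 0

wkT : ∀ {n} → Tm n → Tm (suc n)
wkT (fv a) = fv a
wkT (cn c) = cn c
wkT (bv i) = bv (suc i)

ext : ∀ {n m} → (Fin n → Tm m) → Fin (suc n) → Tm (suc m)
ext σ zero    = bv zero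
ext σ (suc i) = wkT (σ i)

substT : ∀ {n m} → (Fin n → Tm m) → Tm n → Tm m
substT σ (fv a) = fv a
substT σ (cn c) = cn c
substT σ (bv i) = σ i

substF : ∀ {n m} → (Fin n → Tm m) → Fm n → Fm m
substF σ (pr p k ts) = pr p k (map (substT σ) ts)
substF σ ⊤'          = ⊤'
substF σ (φ ∧' ψ)    = substF σ φ ∧' substF σ ψ
substF σ (φ ∨' ψ)    = substF σ φ ∨' substF σ ψ
substF σ (φ ⇒' ψ)    = substF σ φ ⇒' substF σ ψ
substF σ (∀' φ)      = ∀' (substF (ext σ) φ)
substF σ (∃' φ)      = ∃' (substF (ext σ) φ)

closeT : ∀ {n} → Term → Tm n
closeT (fv a) = fv a
closeT (cn c) = cn c

_[_] : Fm 1 → Term → Formula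
φ [ u ] = substF (λ { zero → u }) φ

wkF : Formula → Fm 1
wkF = substF (λ ())

OccT : ∀ {n} → ℕ → Tm n → Set
OccT a (fv b) = a ≡ b
OccT a (cn c) = ⊥
OccT a (bv i) = ⊥

OccF : ∀ {n} → ℕ → Fm n → Set
OccF a (pr p k ts) = VAny.Any (OccT a) ts
OccF a ⊤'          = ⊥
OccF a (φ ∧' ψ)    = OccF a φ ⊎ OccF a ψ
OccF a (φ ∨' ψ)    = OccF a φ ⊎ OccF a ψ
OccF a (φ ⇒' ψ)    = OccF a φ ⊎ OccF a ψ
OccF a (∀' φ)      = OccF a φ
OccF a (∃' φ)      = OccF a φ

OccL : ℕ → List Formula → Set
OccL a Γ = LAny.Any (OccF a) Γ

-- Finite sets of formulas are represented by lists, considered up to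
-- having the same elements (structural rule  setM / setS  below).

_≋_ : List Formula → List Formula → Set
Γ ≋ Γ' = ∀ φ → (φ ∈ Γ → φ ∈ Γ') × (φ ∈ Γ' → φ ∈ Γ)

infix 2 _⊢M_ _⊢S_

-- QGPM  (multi-conclusion).  Γ , φ  is written  φ ∷ Γ.

data _⊢M_ : List Formula → List Formula → Set where
  ax   : ∀ {φ} → (φ ∷ []) ⊢M (φ ∷ [])
  ax⊤  : [] ⊢M (⊤' ∷ [])
  ∧L   : ∀ {Γ Δ φ ψ} → (φ ∷ ψ ∷ Γ) ⊢M Δ → ((φ ∧' ψ) ∷ Γ) ⊢M Δ
  ∧R   : ∀ {Γ Δ φ ψ} → Γ ⊢M (φ ∷ Δ) → Γ ⊢M (ψ ∷ Δ) → Γ ⊢M ((φ ∧' ψ) ∷ Δ)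
  ∨L   : ∀ {Γ Δ φ ψ} → (φ ∷ Γ) ⊢M Δ → (ψ ∷ Γ) ⊢M Δ → ((φ ∨' ψ) ∷ Γ) ⊢M Δ
  ∨R   : ∀ {Γ Δ φ ψ} → Γ ⊢M (φ ∷ ψ ∷ Δ) → Γ ⊢M ((φ ∨' ψ) ∷ Δ)
  ⇒L   : ∀ {Γ Δ φ ψ} → (ψ ∷ Γ) ⊢M Δ → Γ ⊢M (φ ∷ Δ) → ((φ ⇒' ψ) ∷ Γ) ⊢M Δ
  ⇒Rp  : ∀ {Γ Δ φ ψ} → Γ ⊢M (ψ ∷ Δ) → Γ ⊢M ((φ ⇒' ψ) ∷ Δ)
  ∀R   : ∀ {Γ Δ φ} a → Γ ⊢M ((φ [ fv a ]) ∷ Δ)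
         → ¬ OccL a Γ → ¬ OccL a (∀' φ ∷ Δ) → Γ ⊢M (∀' φ ∷ Δ)
  ∀L   : ∀ {Γ Δ φ} (u : Term) → ((φ [ u ]) ∷ Γ) ⊢M Δ → (∀' φ ∷ Γ) ⊢M Δ
  ∃R   : ∀ {Γ Δ φ} (u : Term) → Γ ⊢M ((φ [ u ]) ∷ Δ) → Γ ⊢M (∃' φ ∷ Δ)
  ∃L   : ∀ {Γ Δ φ} a → ((φ [ fv a ]) ∷ Γ) ⊢M Δ
         → ¬ OccL a (∃' φ ∷ Γ) → ¬ OccL a Δ → (∃' φ ∷ Γ) ⊢M Δ
  wk   : ∀ {Γ Δ} Γ₁ Δ₁ → Γ ⊢M Δ → (Γ ++ Γ₁) ⊢M (Δ ++ Δ₁)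
  cut  : ∀ {Γ Δ Γ₁ Δ₁ φ} → Γ ⊢M (φ ∷ Δ) → (φ ∷ Γ₁) ⊢M Δ₁
         → (Γ ++ Γ₁) ⊢M (Δ ++ Δ₁)
  setM : ∀ {Γ Γ' Δ Δ'} → Γ ≋ Γ' → Δ ≋ Δ' → Γ ⊢M Δ → Γ' ⊢M Δ'

data _⊢S_ : List Formula → Formula → Set where
  ax   : ∀ {φ} → (φ ∷ []) ⊢S φ
  ax⊤  : [] ⊢S ⊤'
  ∧L   : ∀ {Γ θ φ ψ} → (φ ∷ ψ ∷ Γ) ⊢S θ → ((φ ∧' ψ) ∷ Γ) ⊢S θ
  ∧R   : ∀ {Γ φ ψ} → Γ ⊢S φ → Γ ⊢S ψ → Γ ⊢S (φ ∧' ψ)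
  ∨L   : ∀ {Γ θ φ ψ} → (φ ∷ Γ) ⊢S θ → (ψ ∷ Γ) ⊢S θ → ((φ ∨' ψ) ∷ Γ) ⊢S θ
  ∨R₁  : ∀ {Γ φ ψ} → Γ ⊢S φ → Γ ⊢S (φ ∨' ψ)
  ∨R₂  : ∀ {Γ φ ψ} → Γ ⊢S ψ → Γ ⊢S (φ ∨' ψ)
  ⇒L   : ∀ {Γ θ φ ψ} → (ψ ∷ Γ) ⊢S θ → Γ ⊢S φ → ((φ ⇒' ψ) ∷ Γ) ⊢S θ
  ⇒Rp  : ∀ {Γ φ ψ} → Γ ⊢S ψ → Γ ⊢S (φ ⇒' ψ)
  ∀R   : ∀ {Γ φ} a → Γ ⊢S (φ [ fv a ])
         → ¬ OccL a Γ → ¬ OccF a (∀' φ) → Γ ⊢S ∀' φ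
  ∀L   : ∀ {Γ θ φ} (u : Term) → ((φ [ u ]) ∷ Γ) ⊢S θ → (∀' φ ∷ Γ) ⊢S θ
  ∃R   : ∀ {Γ φ} (u : Term) → Γ ⊢S (φ [ u ]) → Γ ⊢S ∃' φ
  ∃L   : ∀ {Γ θ φ} a → ((φ [ fv a ]) ∷ Γ) ⊢S θ
         → ¬ OccL a (∃' φ ∷ Γ) → ¬ OccF a θ → (∃' φ ∷ Γ) ⊢S θ
  wk   : ∀ {Γ θ} Γ₁ → Γ ⊢S θ → (Γ ++ Γ₁) ⊢S θ
  cut  : ∀ {Γ Γ₁ θ φ} → Γ ⊢S φ → (φ ∷ Γ₁) ⊢S θ → (Γ ++ Γ₁) ⊢S θ
  setS : ∀ {Γ Γ' θ} → Γ ≋ Γ' → Γ ⊢S θ → Γ' ⊢S θ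

CDlhs : Formula → Fm 1 → Formula
CDlhs A B = ∀' (wkF A ∨' B)

CDrhs : Formula → Fm 1 → Formula
CDrhs A B = A ∨' ∀' B

-- In QGPM the rule ∀R keeps the side formula A on the right, so from
-- ∀x(A ∨ B x) one derives B a, A for a fresh a and generalises over a.
-- QGP is sound for intuitionistic Kripke models, and the two-world model
-- root ≤ top with domains {false} ⊆ {false, true}, A true only at top and
-- B d true exactly when d = false, forces ∀x(A ∨ B x) at the root but
-- neither A nor ∀x B x there (B fails of true at top).
module Submission where

open import Defs
open import Data.Bool using (Bool; true; false)
open import Data.Empty using (⊥; ⊥-elim)
open import Data.Fin using (Fin; zero; suc)
open import Data.List using (List; []; _∷_)
open import Data.List.Membership.Propositional using (_∈_)
open import Data.List.Relation.Unary.All as All using (All; []; _∷_)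
open import Data.List.Relation.Unary.All.Properties using (++⁻ˡ; ++⁻)
open import Data.List.Relation.Unary.Any using (here; there)
open import Data.List.Relation.Unary.Any.Properties using (++⁺ˡ)
open import Data.Nat using (ℕ; suc; _≤_; _⊔_; _≟_)
open import Data.Nat.Properties using (≤-trans; m≤m⊔n; m≤n⊔m; 1+n≰n)
open import Data.Product using (Σ; ∃; ∃₂; _×_; _,_; proj₁)
open import Data.Sum using (_⊎_; inj₁; inj₂)
open import Data.Unit using (⊤; tt)
open import Data.Vec using (Vec; []; _∷_; map; lookup; replicate)
open import Data.Vec.Properties using (map-∘; map-cong; map-id; lookup-replicate)
open import Data.Vec.Relation.Unary.Any as VAny using ()
open import Function using (id; _∘_; const)
open import Relation.Binary.PropositionalEquality using (_≡_; refl; sym; trans; cong; cong₂; subst)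
open import Relation.Nullary using (¬_; yes; no)

substT-ext-wkT : ∀ {m k} (τ : Fin m → Tm k) (t : Tm m) → substT (ext τ) (wkT t) ≡ wkT (substT τ t)
substT-ext-wkT τ (fv a) = refl
substT-ext-wkT τ (cn c) = refl
substT-ext-wkT τ (bv i) = refl

ext-cancel : ∀ {n m} {σ : Fin n → Tm m} {τ : Fin m → Tm n}
  → (∀ i → substT τ (σ i) ≡ bv i) → ∀ i → substT (ext τ) (ext σ i) ≡ bv i
ext-cancel h zero = refl
ext-cancel {σ = σ} {τ} h (suc i) = trans (substT-ext-wkT τ (σ i)) (cong wkT (h i))

substF-cancel : ∀ {n m} (σ : Fin n → Tm m) (τ : Fin m → Tm n)
  → (∀ i → substT τ (σ i) ≡ bv i) → ∀ φ → substF τ (substF σ φ) ≡ φ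
substF-cancel σ τ h (pr p k ts) = cong (pr p k) map-cancel
  where
  substT-cancel : ∀ t → substT τ (substT σ t) ≡ t
  substT-cancel (fv a) = refl
  substT-cancel (cn c) = refl
  substT-cancel (bv i) = h i
  map-cancel : map (substT τ) (map (substT σ) ts) ≡ ts
  map-cancel = trans (sym (map-∘ _ _ ts)) (trans (map-cong substT-cancel ts) (map-id ts))
substF-cancel σ τ h ⊤'       = refl
substF-cancel σ τ h (φ ∧' ψ) = cong₂ _∧'_ (substF-cancel σ τ h φ) (substF-cancel σ τ h ψ)
substF-cancel σ τ h (φ ∨' ψ) = cong₂ _∨'_ (substF-cancel σ τ h φ) (substF-cancel σ τ h ψ)
substF-cancel σ τ h (φ ⇒' ψ) = cong₂ _⇒'_ (substF-cancel σ τ h φ) (substF-cancel σ τ h ψ)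
substF-cancel σ τ h (∀' φ)   = cong ∀' (substF-cancel (ext σ) (ext τ) (ext-cancel h) φ)
substF-cancel σ τ h (∃' φ)   = cong ∃' (substF-cancel (ext σ) (ext τ) (ext-cancel h) φ)

wkF-instance : ∀ (A : Formula) (u : Term) → wkF A [ u ] ≡ A
wkF-instance A u = substF-cancel (λ ()) _ (λ ()) A

maxFvᵛ : ∀ {n k} → Vec (Tm n) k → ℕ
maxFvᵛ []          = 0
maxFvᵛ (fv a ∷ ts) = a ⊔ maxFvᵛ ts
maxFvᵛ (cn _ ∷ ts) = maxFvᵛ ts
maxFvᵛ (bv _ ∷ ts) = maxFvᵛ ts

maxFv : ∀ {n} → Fm n → ℕ
maxFv (pr _ _ ts) = maxFvᵛ ts
maxFv ⊤'          = 0
maxFv (φ ∧' ψ)    = maxFv φ ⊔ maxFv ψ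
maxFv (φ ∨' ψ)    = maxFv φ ⊔ maxFv ψ
maxFv (φ ⇒' ψ)    = maxFv φ ⊔ maxFv ψ
maxFv (∀' φ)      = maxFv φ
maxFv (∃' φ)      = maxFv φ

maxFvˡ : List Formula → ℕ
maxFvˡ []      = 0
maxFvˡ (φ ∷ Γ) = maxFv φ ⊔ maxFvˡ Γ

Occ⇒≤maxFvᵛ : ∀ {n k a} (ts : Vec (Tm n) k) → VAny.Any (OccT a) ts → a ≤ maxFvᵛ ts
Occ⇒≤maxFvᵛ (fv b ∷ ts) (VAny.here refl) = m≤m⊔n b (maxFvᵛ ts)
Occ⇒≤maxFvᵛ (fv b ∷ ts) (VAny.there o)   = ≤-trans (Occ⇒≤maxFvᵛ ts o) (m≤n⊔m b (maxFvᵛ ts))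
Occ⇒≤maxFvᵛ (cn _ ∷ ts) (VAny.there o)   = Occ⇒≤maxFvᵛ ts o
Occ⇒≤maxFvᵛ (bv _ ∷ ts) (VAny.there o)   = Occ⇒≤maxFvᵛ ts o

OccF⇒≤maxFv : ∀ {n a} (φ : Fm n) → OccF a φ → a ≤ maxFv φ
OccF⇒≤maxFv (pr _ _ ts) o        = Occ⇒≤maxFvᵛ ts o
OccF⇒≤maxFv (φ ∧' ψ)    (inj₁ o) = ≤-trans (OccF⇒≤maxFv φ o) (m≤m⊔n _ _)
OccF⇒≤maxFv (φ ∧' ψ)    (inj₂ o) = ≤-trans (OccF⇒≤maxFv ψ o) (m≤n⊔m _ _)
OccF⇒≤maxFv (φ ∨' ψ)    (inj₁ o) = ≤-trans (OccF⇒≤maxFv φ o) (m≤m⊔n _ _)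
OccF⇒≤maxFv (φ ∨' ψ)    (inj₂ o) = ≤-trans (OccF⇒≤maxFv ψ o) (m≤n⊔m _ _)
OccF⇒≤maxFv (φ ⇒' ψ)    (inj₁ o) = ≤-trans (OccF⇒≤maxFv φ o) (m≤m⊔n _ _)
OccF⇒≤maxFv (φ ⇒' ψ)    (inj₂ o) = ≤-trans (OccF⇒≤maxFv ψ o) (m≤n⊔m _ _)
OccF⇒≤maxFv (∀' φ)      o        = OccF⇒≤maxFv φ o
OccF⇒≤maxFv (∃' φ)      o        = OccF⇒≤maxFv φ o

OccL⇒≤maxFvˡ : ∀ {a} (Γ : List Formula) → OccL a Γ → a ≤ maxFvˡ Γ
OccL⇒≤maxFvˡ (φ ∷ Γ) (here o)  = ≤-trans (OccF⇒≤maxFv φ o) (m≤m⊔n _ _)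
OccL⇒≤maxFvˡ (φ ∷ Γ) (there o) = ≤-trans (OccL⇒≤maxFvˡ Γ o) (m≤n⊔m _ _)

fresh : (Γ : List Formula) → ∃ λ a → ¬ OccL a Γ
fresh Γ = suc (maxFvˡ Γ) , λ o → 1+n≰n (OccL⇒≤maxFvˡ Γ o)

≋-refl : ∀ {Γ} → Γ ≋ Γ
≋-refl φ = id , id

≋-swap : ∀ {φ ψ} → (φ ∷ ψ ∷ []) ≋ (ψ ∷ φ ∷ [])
≋-swap θ = swap , swap
  where
  swap : ∀ {φ ψ} → θ ∈ (φ ∷ ψ ∷ []) → θ ∈ (ψ ∷ φ ∷ [])
  swap (here p)         = there (here p)
  swap (there (here p)) = here p

constantDomain-QGPM : (A : Formula) (B : Fm 1) → (CDlhs A B ∷ []) ⊢M (CDrhs A B ∷ [])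
constantDomain-QGPM A B with fresh (CDlhs A B ∷ ∀' B ∷ A ∷ [])
... | a , a∉ =
  ∨R (setM ≋-refl ≋-swap (∀R a (∀L (fv a) (∨L fromA fromB)) (a∉ ∘ ++⁺ˡ) (a∉ ∘ there)))
  where
  fromA : (wkF A [ fv a ] ∷ []) ⊢M (B [ fv a ] ∷ A ∷ [])
  fromA rewrite wkF-instance A (fv a) = setM ≋-refl ≋-swap (wk [] (B [ fv a ] ∷ []) ax)
  fromB : (B [ fv a ] ∷ []) ⊢M (B [ fv a ] ∷ A ∷ [])
  fromB = wk [] (A ∷ []) ax

evalTm : ∀ {n} → Vec Bool n → (ℕ → Bool) → Tm n → Bool
evalTm e ρ (fv a) = ρ a
evalTm e ρ (cn _) = false
evalTm e ρ (bv i) = lookup e i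

-- The top world is an ordinary two-element structure: A is pr 0 0 and B is pr 1 1.
TopAtom : (p k : ℕ) → Vec Bool k → Set
TopAtom 0 0 []       = ⊤
TopAtom 1 1 (d ∷ []) = d ≡ false
TopAtom _ _ _        = ⊥

-- Quantifiers over the domain Bool are unfolded into × and ⊎, so that the
-- substitution lemmas below are equations between types, needing no funext.
Top : ∀ {n} → Vec Bool n → (ℕ → Bool) → Fm n → Set
Top e ρ (pr p k ts) = TopAtom p k (map (evalTm e ρ) ts)
Top e ρ ⊤'          = ⊤
Top e ρ (φ ∧' ψ)    = Top e ρ φ × Top e ρ ψ
Top e ρ (φ ∨' ψ)    = Top e ρ φ ⊎ Top e ρ ψ
Top e ρ (φ ⇒' ψ)    = Top e ρ φ → Top e ρ ψ
Top e ρ (∀' φ)      = Top (true ∷ e) ρ φ × Top (false ∷ e) ρ φ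
Top e ρ (∃' φ)      = Top (true ∷ e) ρ φ ⊎ Top (false ∷ e) ρ φ

Top-∀-elim : ∀ {n} {e : Vec Bool n} {ρ φ} → Top e ρ (∀' φ) → ∀ d → Top (d ∷ e) ρ φ
Top-∀-elim (t , _) true  = t
Top-∀-elim (_ , f) false = f

Top-∃-intro : ∀ {n} {e : Vec Bool n} {ρ φ} d → Top (d ∷ e) ρ φ → Top e ρ (∃' φ)
Top-∃-intro true  = inj₁
Top-∃-intro false = inj₂

Top-∃-elim : ∀ {n} {e : Vec Bool n} {ρ φ} → Top e ρ (∃' φ) → Σ Bool λ d → Top (d ∷ e) ρ φ
Top-∃-elim (inj₁ t) = true , t
Top-∃-elim (inj₂ f) = false , f

evalTm-ext : ∀ {n m} {σ : Fin n → Tm m} {e e' ρ}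
  → (∀ i → evalTm e ρ (σ i) ≡ lookup e' i)
  → ∀ d i → evalTm (d ∷ e) ρ (ext σ i) ≡ lookup (d ∷ e') i
evalTm-ext h d zero = refl
evalTm-ext {σ = σ} h d (suc i) with σ i | h i
... | fv _ | eq = eq
... | cn _ | eq = eq
... | bv _ | eq = eq

Top-substF : ∀ {n m} (σ : Fin n → Tm m) {e e' ρ}
  → (∀ i → evalTm e ρ (σ i) ≡ lookup e' i) → ∀ φ → Top e ρ (substF σ φ) ≡ Top e' ρ φ
Top-substF σ {e} {e'} {ρ} h (pr p k ts) = cong (TopAtom p k) map-evalTm
  where
  evalTm-substT : ∀ t → evalTm e ρ (substT σ t) ≡ evalTm e' ρ t
  evalTm-substT (fv a) = refl
  evalTm-substT (cn c) = refl
  evalTm-substT (bv i) = h i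
  map-evalTm : map (evalTm e ρ) (map (substT σ) ts) ≡ map (evalTm e' ρ) ts
  map-evalTm = trans (sym (map-∘ _ _ ts)) (map-cong evalTm-substT ts)
Top-substF σ h ⊤'       = refl
Top-substF σ h (φ ∧' ψ) = cong₂ _×_ (Top-substF σ h φ) (Top-substF σ h ψ)
Top-substF σ h (φ ∨' ψ) = cong₂ _⊎_ (Top-substF σ h φ) (Top-substF σ h ψ)
Top-substF σ h (φ ⇒' ψ) = cong₂ (λ P Q → P → Q) (Top-substF σ h φ) (Top-substF σ h ψ)
Top-substF σ h (∀' φ)   =
  cong₂ _×_ (Top-substF (ext σ) (evalTm-ext h true) φ) (Top-substF (ext σ) (evalTm-ext h false) φ)
Top-substF σ h (∃' φ)   =
  cong₂ _⊎_ (Top-substF (ext σ) (evalTm-ext h true) φ) (Top-substF (ext σ) (evalTm-ext h false) φ)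

Top-instance : ∀ {ρ} (φ : Fm 1) (u : Term) → Top [] ρ (φ [ u ]) ≡ Top (evalTm [] ρ u ∷ []) ρ φ
Top-instance φ u = Top-substF _ (λ { zero → refl }) φ

map-evalTm-cong : ∀ {n k} {e : Vec Bool n} {ρ ρ'} (ts : Vec (Tm n) k)
  → (∀ a → VAny.Any (OccT a) ts → ρ a ≡ ρ' a) → map (evalTm e ρ) ts ≡ map (evalTm e ρ') ts
map-evalTm-cong []          h = refl
map-evalTm-cong (fv a ∷ ts) h = cong₂ _∷_ (h a (VAny.here refl)) (map-evalTm-cong ts (λ b → h b ∘ VAny.there))
map-evalTm-cong (cn _ ∷ ts) h = cong (false ∷_) (map-evalTm-cong ts (λ b → h b ∘ VAny.there))
map-evalTm-cong (bv i ∷ ts) h = cong (_ ∷_) (map-evalTm-cong ts (λ b → h b ∘ VAny.there))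

Top-cong : ∀ {n} {e : Vec Bool n} {ρ ρ'} (φ : Fm n)
  → (∀ a → OccF a φ → ρ a ≡ ρ' a) → Top e ρ φ ≡ Top e ρ' φ
Top-cong (pr p k ts) h = cong (TopAtom p k) (map-evalTm-cong ts h)
Top-cong ⊤'          h = refl
Top-cong (φ ∧' ψ)    h = cong₂ _×_ (Top-cong φ (λ a → h a ∘ inj₁)) (Top-cong ψ (λ a → h a ∘ inj₂))
Top-cong (φ ∨' ψ)    h = cong₂ _⊎_ (Top-cong φ (λ a → h a ∘ inj₁)) (Top-cong ψ (λ a → h a ∘ inj₂))
Top-cong (φ ⇒' ψ)    h =
  cong₂ (λ P Q → P → Q) (Top-cong φ (λ a → h a ∘ inj₁)) (Top-cong ψ (λ a → h a ∘ inj₂))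
Top-cong (∀' φ)      h = cong₂ _×_ (Top-cong φ h) (Top-cong φ h)
Top-cong (∃' φ)      h = cong₂ _⊎_ (Top-cong φ h) (Top-cong φ h)

_[_≔_] : (ℕ → Bool) → ℕ → Bool → ℕ → Bool
(ρ [ a ≔ d ]) b with b ≟ a
... | yes _ = d
... | no  _ = ρ b

update-same : ∀ ρ a d → (ρ [ a ≔ d ]) a ≡ d
update-same ρ a d with a ≟ a
... | yes _   = refl
... | no  a≢a = ⊥-elim (a≢a refl)

update-elsewhere : ∀ {n} {ρ a d} (φ : Fm n) → ¬ OccF a φ → ∀ b → OccF b φ → ρ b ≡ (ρ [ a ≔ d ]) b
update-elsewhere {a = a} φ a∉φ b o with b ≟ a
... | yes refl = ⊥-elim (a∉φ o)
... | no  _    = refl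

Top-update : ∀ {n} {e : Vec Bool n} {ρ a d} (φ : Fm n) → ¬ OccF a φ → Top e ρ φ ≡ Top e (ρ [ a ≔ d ]) φ
Top-update φ a∉φ = Top-cong φ (update-elsewhere φ a∉φ)

All-Top-update : ∀ {Γ ρ a d} → ¬ OccL a Γ → All (Top [] ρ) Γ → All (Top [] (ρ [ a ≔ d ])) Γ
All-Top-update           a∉Γ []      = []
All-Top-update {φ ∷ Γ} a∉Γ (t ∷ γ) =
  subst id (Top-update φ (a∉Γ ∘ here)) t ∷ All-Top-update (a∉Γ ∘ there) γ

Top-eigen-instance : ∀ {ρ a} (φ : Fm 1) d → ¬ OccF a φ
  → Top [] (ρ [ a ≔ d ]) (φ [ fv a ]) ≡ Top (d ∷ []) ρ φ
Top-eigen-instance {ρ} {a} φ d a∉φ =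
  trans (Top-substF _ (λ { zero → update-same ρ a d }) φ) (sym (Top-update φ a∉φ))

All-≋ : ∀ {P : Formula → Set} {Γ Γ'} → Γ ≋ Γ' → All P Γ' → All P Γ
All-≋ Γ≋Γ' γ = All.tabulate λ {φ} φ∈Γ → All.lookup γ (proj₁ (Γ≋Γ' φ) φ∈Γ)

Top-sound : ∀ {Γ θ} → Γ ⊢S θ → ∀ ρ → All (Top [] ρ) Γ → Top [] ρ θ
Top-sound ax                   ρ (t ∷ [])          = t
Top-sound ax⊤                  ρ γ                 = tt
Top-sound (∧L d)               ρ ((s , t) ∷ γ)     = Top-sound d ρ (s ∷ t ∷ γ)
Top-sound (∧R d d')            ρ γ                 = Top-sound d ρ γ , Top-sound d' ρ γ
Top-sound (∨L d d')            ρ (inj₁ s ∷ γ)      = Top-sound d ρ (s ∷ γ)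
Top-sound (∨L d d')            ρ (inj₂ t ∷ γ)      = Top-sound d' ρ (t ∷ γ)
Top-sound (∨R₁ d)              ρ γ                 = inj₁ (Top-sound d ρ γ)
Top-sound (∨R₂ d)              ρ γ                 = inj₂ (Top-sound d ρ γ)
Top-sound (⇒L d d')            ρ (f ∷ γ)           = Top-sound d ρ (f (Top-sound d' ρ γ) ∷ γ)
Top-sound (⇒Rp d)              ρ γ                 = λ _ → Top-sound d ρ γ
Top-sound (∀R {φ = φ} a d a∉Γ a∉φ) ρ γ = at true , at false
  where
  at : ∀ b → Top (b ∷ []) ρ φ
  at b = subst id (Top-eigen-instance φ b a∉φ) (Top-sound d (ρ [ a ≔ b ]) (All-Top-update a∉Γ γ))
Top-sound (∀L {φ = φ} u d)     ρ (t ∷ γ)           =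
  Top-sound d ρ (subst id (sym (Top-instance φ u)) (Top-∀-elim {φ = φ} t (evalTm [] ρ u)) ∷ γ)
Top-sound (∃R {φ = φ} u d)     ρ γ                 =
  Top-∃-intro {φ = φ} (evalTm [] ρ u) (subst id (Top-instance φ u) (Top-sound d ρ γ))
Top-sound (∃L {Γ} {θ} {φ} a d a∉ a∉θ) ρ (t ∷ γ) with Top-∃-elim {φ = φ} t
... | b , s = subst id (sym (Top-update θ a∉θ)) (Top-sound d (ρ [ a ≔ b ]) (s' ∷ γ'))
  where
  s' : Top [] (ρ [ a ≔ b ]) (φ [ fv a ])
  s' = subst id (sym (Top-eigen-instance φ b (a∉ ∘ here))) s
  γ' : All (Top [] (ρ [ a ≔ b ])) Γ
  γ' = All-Top-update (a∉ ∘ there) γ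
Top-sound (wk {Γ = Γ} _ d)     ρ γ                 = Top-sound d ρ (++⁻ˡ Γ γ)
Top-sound (cut {Γ = Γ} d d')   ρ γ with ++⁻ Γ γ
... | γ₁ , γ₂ = Top-sound d' ρ (Top-sound d ρ γ₁ ∷ γ₂)
Top-sound (setS Γ≋Γ' d)        ρ γ                 = Top-sound d ρ (All-≋ Γ≋Γ' γ)

falses : (n : ℕ) → Vec Bool n
falses n = replicate n false

-- Truth at top when every variable and constant denotes the root's only individual, false.
Top₀ : ∀ {n} → Fm n → Set
Top₀ {n} = Top (falses n) (const false)

evalTm-falses : ∀ {n} (t : Tm n) → evalTm (falses n) (const false) t ≡ false
evalTm-falses (fv _) = refl
evalTm-falses (cn _) = refl
evalTm-falses (bv i) = lookup-replicate i false

RootAtom : (p k : ℕ) → Set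
RootAtom 1 1 = ⊤
RootAtom _ _ = ⊥

-- Forcing at the root.  Its domain has one individual, so terms are irrelevant;
-- ⇒ and ∀ also look at the top world, through Top₀.
Root : ∀ {n} → Fm n → Set
Root (pr p k _) = RootAtom p k
Root ⊤'         = ⊤
Root (φ ∧' ψ)   = Root φ × Root ψ
Root (φ ∨' ψ)   = Root φ ⊎ Root ψ
Root (φ ⇒' ψ)   = (Root φ → Root ψ) × Top₀ (φ ⇒' ψ)
Root (∀' φ)     = Root φ × Top₀ (∀' φ)
Root (∃' φ)     = Root φ

Root⇒Top₀ : ∀ {n} (φ : Fm n) → Root φ → Top₀ φ
Root⇒Top₀ (pr 0 _ _)               ()
Root⇒Top₀ (pr 1 0 _)               ()
Root⇒Top₀ (pr 1 1 (t ∷ []))        _        = evalTm-falses t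
Root⇒Top₀ (pr 1 (suc (suc _)) _)   ()
Root⇒Top₀ (pr (suc (suc _)) _ _)   ()
Root⇒Top₀ ⊤'                       _        = tt
Root⇒Top₀ (φ ∧' ψ)                 (r , s)  = Root⇒Top₀ φ r , Root⇒Top₀ ψ s
Root⇒Top₀ (φ ∨' ψ)                 (inj₁ r) = inj₁ (Root⇒Top₀ φ r)
Root⇒Top₀ (φ ∨' ψ)                 (inj₂ s) = inj₂ (Root⇒Top₀ ψ s)
Root⇒Top₀ (φ ⇒' ψ)                 (_ , t)  = t
Root⇒Top₀ (∀' φ)                   (_ , t)  = t
Root⇒Top₀ (∃' φ)                   r        = inj₂ (Root⇒Top₀ φ r)

Top₀-substF : ∀ {n m} (σ : Fin n → Tm m) φ → Top₀ (substF σ φ) ≡ Top₀ φ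
Top₀-substF σ = Top-substF σ λ i → trans (evalTm-falses (σ i)) (sym (lookup-replicate i false))

Root-substF : ∀ {n m} (σ : Fin n → Tm m) φ → Root (substF σ φ) ≡ Root φ
Root-substF σ (pr p k ts) = refl
Root-substF σ ⊤'          = refl
Root-substF σ (φ ∧' ψ)    = cong₂ _×_ (Root-substF σ φ) (Root-substF σ ψ)
Root-substF σ (φ ∨' ψ)    = cong₂ _⊎_ (Root-substF σ φ) (Root-substF σ ψ)
Root-substF σ (φ ⇒' ψ)    =
  cong₂ _×_ (cong₂ (λ P Q → P → Q) (Root-substF σ φ) (Root-substF σ ψ)) (Top₀-substF σ (φ ⇒' ψ))
Root-substF σ (∀' φ)      = cong₂ _×_ (Root-substF (ext σ) φ) (Top₀-substF σ (∀' φ))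
Root-substF σ (∃' φ)      = Root-substF (ext σ) φ

Root-instance : (φ : Fm 1) (u : Term) → Root (φ [ u ]) ≡ Root φ
Root-instance φ u = Root-substF _ φ

Root-sound : ∀ {Γ θ} → Γ ⊢S θ → All Root Γ → Root θ
Root-sound ax                 (r ∷ [])         = r
Root-sound ax⊤                γ                = tt
Root-sound (∧L d)             ((r , s) ∷ γ)    = Root-sound d (r ∷ s ∷ γ)
Root-sound (∧R d d')          γ                = Root-sound d γ , Root-sound d' γ
Root-sound (∨L d d')          (inj₁ r ∷ γ)     = Root-sound d (r ∷ γ)
Root-sound (∨L d d')          (inj₂ s ∷ γ)     = Root-sound d' (s ∷ γ)
Root-sound (∨R₁ d)            γ                = inj₁ (Root-sound d γ)
Root-sound (∨R₂ d)            γ                = inj₂ (Root-sound d γ)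
Root-sound (⇒L d d')          ((f , _) ∷ γ)    = Root-sound d (f (Root-sound d' γ) ∷ γ)
Root-sound (⇒Rp {ψ = ψ} d)    γ                = (λ _ → r) , (λ _ → Root⇒Top₀ ψ r)
  where
  r : Root ψ
  r = Root-sound d γ
Root-sound (∀R {φ = φ} a d a∉Γ a∉φ) γ =
  subst id (Root-instance φ (fv a)) (Root-sound d γ) ,
  Top-sound (∀R a d a∉Γ a∉φ) (const false) (All.map (λ {ψ} → Root⇒Top₀ ψ) γ)
Root-sound (∀L {φ = φ} u d)   ((r , _) ∷ γ)    = Root-sound d (subst id (sym (Root-instance φ u)) r ∷ γ)
Root-sound (∃R {φ = φ} u d)   γ                = subst id (Root-instance φ u) (Root-sound d γ)
Root-sound (∃L {φ = φ} a d _ _) (r ∷ γ)        = Root-sound d (subst id (sym (Root-instance φ (fv a))) r ∷ γ)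
Root-sound (wk {Γ = Γ} _ d)   γ                = Root-sound d (++⁻ˡ Γ γ)
Root-sound (cut {Γ = Γ} d d') γ with ++⁻ Γ γ
... | γ₁ , γ₂ = Root-sound d' (Root-sound d γ₁ ∷ γ₂)
Root-sound (setS Γ≋Γ' d)      γ                = Root-sound d (All-≋ Γ≋Γ' γ)

A₀ : Formula
A₀ = pr 0 0 []

B₀ : Fm 1
B₀ = pr 1 1 (bv zero ∷ [])

constantDomain-not-QGP : ¬ ((CDlhs A₀ B₀ ∷ []) ⊢S CDrhs A₀ B₀)
constantDomain-not-QGP d with Root-sound d ((inj₂ tt , inj₁ tt , inj₁ tt) ∷ [])
... | inj₁ ()
... | inj₂ (_ , () , _)

lemma1 : ((A : Formula) (B : Fm 1) → (CDlhs A B ∷ []) ⊢M (CDrhs A B ∷ []))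
         × ∃₂ (λ (A : Formula) (B : Fm 1) → ¬ ((CDlhs A B ∷ []) ⊢S CDrhs A B))
lemma1 = constantDomain-QGPM , A₀ , B₀ , constantDomain-not-QGP
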